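{- For every $n\ge 1$, let $G_n^7$ be the graph on vertex set $\{a,b,c,d\}\cup\{1,2,\dots,n\}\cup\{x\}$ with the following edges: among $\{a,b,c,d\}$ exactly the edges $\{a,c\},\{a,d\},\{b,d\}$; among $\{1,\dots,n\}$ every pair $\{i,j\}$ with $|i-j|\ge 2$ (so the only non-edges there are $\{i,i+1\}$, $1\le i\le n-1$); the edges $\{x,i\}$ for all $1\le i\le n$, and $\{x,a\}$, $\{x,d\}$; the edges $\{a,i\}$ for all $2\le i\le n$; and the edges $\{d,i\}$ for all $1\le i\le n-1$. There are no other edges (in particular $b$ and $c$ have no neighbours outside $\{a,b,c,d\}$). Then $G_n^7$ is word-representable.
   Context: All graphs are finite and simple. For a word $w$ and letters $i,j$, let $w_{ij}$ be the subsequence of $w$ consisting of all occurrences of $i$ and $j$; $i$ and $j$ alternate in $w$ if $w_{ij}$ contains no factor $ii$ or $jj$. A graph $G$ is word-representable if there is a word $w$ over $V(G)$ such that for all distinct $i,j\in V(G)$, $\{i,j\}\in E(G)$ if and only if $i$ and $j$ alternate in $w$. -}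

module Defs where

open import Data.Nat using (ℕ; suc; _≤_)
open import Data.Fin using (Fin; toℕ)
open import Data.Bool using (Bool; true; false; T; _∨_; _∧_)
open import Data.List using (List; []; _∷_; filter)
open import Data.Product using (Σ; ∃; _×_; _,_)
open import Data.Sum using (_⊎_)
open import Relation.Nullary using (¬_; Dec; yes; no)
open import Relation.Nullary.Decidable using (_⊎-dec_)
open import Relation.Binary.PropositionalEquality using (_≡_; _≢_)
open import Relation.Binary.Definitions using (DecidableEquality)
open import Function.Bundles using (_⇔_)

module _ {V : Set} (_≟_ : DecidableEquality V) where

  restrict : List V → V → V → List V
  restrict w i j = filter (λ v → (v ≟ i) ⊎-dec (v ≟ j)) w

  data HasFactor (k : V) : List V → Set where
    here  : ∀ {w} → HasFactor k (k ∷ k ∷ w)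
    there : ∀ {v w} → HasFactor k w → HasFactor k (v ∷ w)

  Alternate : List V → V → V → Set
  Alternate w i j =
    ¬ HasFactor i (restrict w i j) × ¬ HasFactor j (restrict w i j)

  WordRepresentable : (V → V → Set) → Set
  WordRepresentable E =
    ∃ λ (w : List V) → ∀ i j → i ≢ j → (E i j ⇔ Alternate w i j)

-- vertices a b c d, 1..n (num k stands for vertex toℕ k + 1), and x
data V7 (n : ℕ) : Set where
  va vb vc vd vx : V7 n
  num : Fin n → V7 n

idx : ∀ {n} → Fin n → ℕ
idx k = suc (toℕ k)

-- directed description of the edges; the graph's edge relation is its
-- symmetric closure
data Arc (n : ℕ) : V7 n → V7 n → Set where
  ac : Arc n va vc
  ad : Arc n va vd
  bd : Arc n vb vd
  ij : ∀ (k l : Fin n) → suc (suc (idx k)) ≤ idx l → Arc n (num k) (num l)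
  xi : ∀ (k : Fin n) → Arc n vx (num k)
  xa : Arc n vx va
  xd : Arc n vx vd
  ai : ∀ (k : Fin n) → 2 ≤ idx k → Arc n va (num k)
  di : ∀ (k : Fin n) → suc (idx k) ≤ n → Arc n vd (num k)

Edge7 : (n : ℕ) → V7 n → V7 n → Set
Edge7 n u v = Arc n u v ⊎ Arc n v u

_≟7_ : ∀ {n} → DecidableEquality (V7 n)
va ≟7 va = yes _≡_.refl
vb ≟7 vb = yes _≡_.refl
vc ≟7 vc = yes _≡_.refl
vd ≟7 vd = yes _≡_.refl
vx ≟7 vx = yes _≡_.refl
num k ≟7 num l with k Data.Fin.≟ l
... | yes _≡_.refl = yes _≡_.refl
... | no k≢l = no λ { _≡_.refl → k≢l _≡_.refl }
va ≟7 vb = no λ ()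
va ≟7 vc = no λ ()
va ≟7 vd = no λ ()
va ≟7 vx = no λ ()
va ≟7 num _ = no λ ()
vb ≟7 va = no λ ()
vb ≟7 vc = no λ ()
vb ≟7 vd = no λ ()
vb ≟7 vx = no λ ()
vb ≟7 num _ = no λ ()
vc ≟7 va = no λ ()
vc ≟7 vb = no λ ()
vc ≟7 vd = no λ ()
vc ≟7 vx = no λ ()
vc ≟7 num _ = no λ ()
vd ≟7 va = no λ ()
vd ≟7 vb = no λ ()
vd ≟7 vc = no λ ()
vd ≟7 vx = no λ ()
vd ≟7 num _ = no λ ()
vx ≟7 va = no λ ()
vx ≟7 vb = no λ ()
vx ≟7 vc = no λ ()
vx ≟7 vd = no λ ()
vx ≟7 num _ = no λ ()
num _ ≟7 va = no λ ()
num _ ≟7 vb = no λ ()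
num _ ≟7 vc = no λ ()
num _ ≟7 vd = no λ ()
num _ ≟7 vx = no λ ()

{-# OPTIONS --safe #-}
module Submission where

-- Order the vertices a, 1, …, n, d along a path. On them G_n^7 is the complement of that
-- path (a–d is an edge because n ≥ 1), x is adjacent to all of them, and b, c are pendant
-- vertices at d and a.
--
-- For a path L take as blocks L itself and every list obtained from L by swapping one
-- adjacent pair, each block preceded by x. Two letters that are not neighbours on L have the
-- same relative order in every block, so they alternate. For neighbours P, Q the block
-- swapping them follows a block with P before Q, which produces the factor P Q Q P.
--
-- A pendant c at v is added by writing c just before the first v and just after every v.
-- Restrictions to pairs avoiding c are unchanged, c alternates with v, and for any other
-- letter y the restriction to {c, y} contains the factor c c.

open import Defs
open import Data.Nat using (ℕ; zero; suc; _+_; _≤_; _<_; z≤n; s≤s; _<?_)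
open import Data.Nat.Properties
  using ( ≤-pred; ≤-trans; <⇒≤; <⇒≢; <-trans; <-≤-trans; <-irrefl; <-cmp; ≤∧≢⇒<; m+n≮n
        ; n<1+n; m≤n⇒m≤1+n )
open import Data.Fin using (toℕ; fromℕ<)
open import Data.Fin.Properties using (toℕ<n; toℕ-fromℕ<; fromℕ<-toℕ)
open import Data.List using (List; []; _∷_; _++_; map; concat; concatMap; applyUpTo)
open import Data.List.Properties
  using (filter-++; filter-accept; filter-reject; filter-≐; map-∘; map-cong)
open import Data.List.Membership.Propositional using (_∈_; _∉_)
open import Data.List.Membership.Propositional.Properties using (∈-applyUpTo⁺; ∈-applyUpTo⁻; ∈-++⁺ˡ)
open import Data.List.Relation.Unary.Any using (here; there)
open import Data.List.Relation.Unary.All as All using (All; []; _∷_)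
import Data.List.Relation.Unary.All.Properties as All
open import Data.List.Relation.Unary.AllPairs using (_∷_)
open import Data.List.Relation.Unary.Unique.Propositional using (Unique)
open import Data.List.Relation.Unary.Unique.Propositional.Properties using (applyUpTo⁺₁)
open import Data.List.Relation.Unary.Linked as Linked using (Linked; []; [-]; _∷_)
open import Data.Product using (∃; ∃₂; _×_; _,_)
open import Data.Sum using (_⊎_; inj₁; inj₂)
import Data.Sum as Sum
open import Data.Sum.Function.Propositional using (_⊎-⇔_)
open import Data.Empty using (⊥-elim)
open import Function using (_∘_)
open import Function.Bundles using (_⇔_; mk⇔; Equivalence)
import Function.Properties.Equivalence as ⇔
open import Function.Related.TypeIsomorphisms using (¬-cong-⇔)
open import Relation.Nullary using (¬_; Dec; yes; no)
open import Relation.Nullary.Decidable using (_⊎-dec_)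
open import Relation.Binary.PropositionalEquality
  using (_≡_; _≢_; refl; sym; trans; cong; cong₂; subst; subst₂)
open import Relation.Binary.Definitions using (DecidableEquality; tri<; tri≈; tri>)

data Consecutive {A : Set} : List A → A → A → Set where
  here  : ∀ {x y zs} → Consecutive (x ∷ y ∷ zs) x y
  there : ∀ {x y z zs} → Consecutive zs x y → Consecutive (z ∷ zs) x y

Neighbours : {A : Set} → List A → A → A → Set
Neighbours L x y = Consecutive L x y ⊎ Consecutive L y x

module _ {A : Set} where

  consecutive-∈ˡ : ∀ {L} {x y : A} → Consecutive L x y → x ∈ L
  consecutive-∈ˡ here      = here refl
  consecutive-∈ˡ (there c) = there (consecutive-∈ˡ c)

  consecutive-∈ʳ : ∀ {L} {x y : A} → Consecutive L x y → y ∈ L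
  consecutive-∈ʳ here      = there (here refl)
  consecutive-∈ʳ (there c) = there (consecutive-∈ʳ c)

  neighbours-∈ˡ : ∀ {L} {x y : A} → Neighbours L x y → x ∈ L
  neighbours-∈ˡ = Sum.[ consecutive-∈ˡ , consecutive-∈ʳ ]

  neighbours-∈ʳ : ∀ {L} {x y : A} → Neighbours L x y → y ∈ L
  neighbours-∈ʳ = Sum.[ consecutive-∈ʳ , consecutive-∈ˡ ]

  consecutive-applyUpTo⁺ : ∀ (f : ℕ → A) {i m} → suc i < m →
                           Consecutive (applyUpTo f m) (f i) (f (suc i))
  consecutive-applyUpTo⁺ f {zero}  (s≤s (s≤s _))          = here
  consecutive-applyUpTo⁺ f {suc i} (s≤s i<m@(s≤s (s≤s _))) =
    there (consecutive-applyUpTo⁺ (f ∘ suc) i<m)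

  consecutive-applyUpTo⁻ : ∀ (f : ℕ → A) {m x y} → Consecutive (applyUpTo f m) x y →
                           ∃ λ i → suc i < m × f i ≡ x × f (suc i) ≡ y
  consecutive-applyUpTo⁻ f {suc (suc m)} here = zero , s≤s (s≤s z≤n) , refl , refl
  consecutive-applyUpTo⁻ f {suc m} (there c) with consecutive-applyUpTo⁻ (f ∘ suc) c
  ... | i , i<m , refl , refl = suc i , s≤s i<m , refl , refl

  adjacentSwaps : List A → List (List A)
  adjacentSwaps (x ∷ y ∷ zs) = (y ∷ x ∷ zs) ∷ map (x ∷_) (adjacentSwaps (y ∷ zs))
  adjacentSwaps _            = []

  pathBlocks : List A → List (List A)
  pathBlocks L = L ∷ adjacentSwaps L

  apexWord : A → List A → List A
  apexWord x L = concatMap (x ∷_) (pathBlocks L)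

  All-adjacentSwaps : ∀ {P : A → Set} {L} → All P L → All (All P) (adjacentSwaps L)
  All-adjacentSwaps (px ∷ py ∷ pzs) =
    (py ∷ px ∷ pzs) ∷ All.map⁺ (All.map (px ∷_) (All-adjacentSwaps (py ∷ pzs)))
  All-adjacentSwaps []       = []
  All-adjacentSwaps (_ ∷ []) = []

  All-apexWord : ∀ {P : A → Set} {x L} → P x → All P L → All P (apexWord x L)
  All-apexWord px pL = All.concat⁺ (All.map⁺ (All.map (px ∷_) (pL ∷ All-adjacentSwaps pL)))

module Alternation {V : Set} (_≟_ : DecidableEquality V) where

  infix 10 _⟨_,_⟩

  _⟨_,_⟩ : List V → V → V → List V
  w ⟨ P , Q ⟩ = restrict _≟_ w P Q

  private
    pair? : (P Q y : V) → Dec (y ≡ P ⊎ y ≡ Q)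
    pair? P Q y = (y ≟ P) ⊎-dec (y ≟ Q)

  module _ {P Q : V} where

    ⟨⟩-keep : ∀ {y} w → y ≡ P ⊎ y ≡ Q → (y ∷ w) ⟨ P , Q ⟩ ≡ y ∷ w ⟨ P , Q ⟩
    ⟨⟩-keep w = filter-accept (pair? P Q)

    ⟨⟩-skip : ∀ {y} w → y ≢ P → y ≢ Q → (y ∷ w) ⟨ P , Q ⟩ ≡ w ⟨ P , Q ⟩
    ⟨⟩-skip w y≢P y≢Q = filter-reject (pair? P Q) Sum.[ y≢P , y≢Q ]

    ⟨⟩-∷-cong : ∀ y {u w} → u ⟨ P , Q ⟩ ≡ w ⟨ P , Q ⟩ → (y ∷ u) ⟨ P , Q ⟩ ≡ (y ∷ w) ⟨ P , Q ⟩
    ⟨⟩-∷-cong y {u} {w} e with pair? P Q y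
    ... | yes y∈ = trans (⟨⟩-keep u y∈) (trans (cong (y ∷_) e) (sym (⟨⟩-keep w y∈)))
    ... | no y∉  = trans (⟨⟩-skip u (y∉ ∘ inj₁) (y∉ ∘ inj₂))
                         (trans e (sym (⟨⟩-skip w (y∉ ∘ inj₁) (y∉ ∘ inj₂))))

    ⟨⟩-++ : ∀ u w → (u ++ w) ⟨ P , Q ⟩ ≡ u ⟨ P , Q ⟩ ++ w ⟨ P , Q ⟩
    ⟨⟩-++ = filter-++ (pair? P Q)

    ⟨⟩-concat : ∀ ws → concat ws ⟨ P , Q ⟩ ≡ concatMap _⟨ P , Q ⟩ ws
    ⟨⟩-concat []       = refl
    ⟨⟩-concat (w ∷ ws) = trans (⟨⟩-++ w (concat ws)) (cong (w ⟨ P , Q ⟩ ++_) (⟨⟩-concat ws))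

    ⟨⟩-none : ∀ {w} → All (P ≢_) w → All (Q ≢_) w → w ⟨ P , Q ⟩ ≡ []
    ⟨⟩-none []                 []                 = refl
    ⟨⟩-none {y ∷ w} (P≢y ∷ Ps) (Q≢y ∷ Qs) =
      trans (⟨⟩-skip w (P≢y ∘ sym) (Q≢y ∘ sym)) (⟨⟩-none Ps Qs)

    ⟨⟩-ordered : ∀ {zs} → All (P ≢_) zs → All (Q ≢_) zs → (P ∷ Q ∷ zs) ⟨ P , Q ⟩ ≡ P ∷ Q ∷ []
    ⟨⟩-ordered P∉ Q∉ =
      trans (⟨⟩-keep _ (inj₁ refl))
        (cong (P ∷_) (trans (⟨⟩-keep _ (inj₂ refl)) (cong (Q ∷_) (⟨⟩-none P∉ Q∉))))

  ⟨⟩-comm : ∀ w {P Q} → w ⟨ P , Q ⟩ ≡ w ⟨ Q , P ⟩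
  ⟨⟩-comm w {P} {Q} = filter-≐ (pair? P Q) (pair? Q P) (Sum.swap , Sum.swap) w

  alternate-sym : ∀ w {P Q} → Alternate _≟_ w P Q → Alternate _≟_ w Q P
  alternate-sym w {P} {Q} (¬P , ¬Q) =
    subst (λ r → ¬ HasFactor _≟_ Q r × ¬ HasFactor _≟_ P r) (⟨⟩-comm w) (¬Q , ¬P)

  alternate-resp : ∀ {u w P Q} → u ⟨ P , Q ⟩ ≡ w ⟨ P , Q ⟩ →
                   Alternate _≟_ u P Q ⇔ Alternate _≟_ w P Q
  alternate-resp {P = P} {Q} e = mk⇔ (subst Alt e) (subst Alt (sym e))
    where Alt = λ r → ¬ HasFactor _≟_ P r × ¬ HasFactor _≟_ Q r

  linked⇒¬factor : ∀ {k xs} → Linked _≢_ xs → ¬ HasFactor _≟_ k xs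
  linked⇒¬factor (x≢y ∷ _) here      = x≢y refl
  linked⇒¬factor (_ ∷ l)   (there f) = linked⇒¬factor l f
  linked⇒¬factor [-]       (there ())

  linked⇒alternate : ∀ {w P Q} → Linked _≢_ (w ⟨ P , Q ⟩) → Alternate _≟_ w P Q
  linked⇒alternate l = linked⇒¬factor l , linked⇒¬factor l

  factor-++ʳ : ∀ {k} u {w} → HasFactor _≟_ k w → HasFactor _≟_ k (u ++ w)
  factor-++ʳ []      f = f
  factor-++ʳ (_ ∷ u) f = there (factor-++ʳ u f)

  factor-∷ : ∀ {k P Q} y w → HasFactor _≟_ k (w ⟨ P , Q ⟩) → HasFactor _≟_ k ((y ∷ w) ⟨ P , Q ⟩)
  factor-∷ {P = P} {Q} y w f with pair? P Q y
  ... | yes y∈ = subst (HasFactor _≟_ _) (sym (⟨⟩-keep w y∈)) (there f)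
  ... | no y∉  = subst (HasFactor _≟_ _) (sym (⟨⟩-skip w (y∉ ∘ inj₁) (y∉ ∘ inj₂))) f

  module _ {P Q : V} where

    uniform-alternate : ∀ {s t} → s ≢ t → ∀ bs → All (λ b → b ⟨ P , Q ⟩ ≡ s ∷ t ∷ []) bs →
                        Alternate _≟_ (concat bs) P Q
    uniform-alternate {s} {t} s≢t bs es = linked⇒alternate {concat bs} (Linked.tail (linked bs es))
      where
      linked : ∀ bs → All (λ b → b ⟨ P , Q ⟩ ≡ s ∷ t ∷ []) bs → Linked _≢_ (t ∷ concat bs ⟨ P , Q ⟩)
      linked []       []       = [-]
      linked (b ∷ bs) (e ∷ es) rewrite ⟨⟩-++ {P} {Q} b (concat bs) | e =
        (s≢t ∘ sym) ∷ s≢t ∷ linked bs es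

    flipped-¬alternate : ∀ bs → Consecutive (map _⟨ P , Q ⟩ bs) (P ∷ Q ∷ []) (Q ∷ P ∷ []) →
                         ¬ Alternate _≟_ (concat bs) P Q
    flipped-¬alternate bs c (_ , ¬Q) = ¬Q (subst (HasFactor _≟_ Q) (sym (⟨⟩-concat bs)) (factor c))
      where
      factor : ∀ {rs} → Consecutive rs (P ∷ Q ∷ []) (Q ∷ P ∷ []) → HasFactor _≟_ Q (concat rs)
      factor here              = there here
      factor (there {z = r} c) = factor-++ʳ r (factor c)

    ⟨⟩-swap : ∀ {x y} zs → ¬ Neighbours (x ∷ y ∷ zs) P Q →
              (y ∷ x ∷ zs) ⟨ P , Q ⟩ ≡ (x ∷ y ∷ zs) ⟨ P , Q ⟩
    ⟨⟩-swap {x} {y} zs ¬nb with pair? P Q y | pair? P Q x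
    ... | no y∉ | _ = trans (⟨⟩-skip (x ∷ zs) (y∉ ∘ inj₁) (y∉ ∘ inj₂))
                            (⟨⟩-∷-cong x (sym (⟨⟩-skip zs (y∉ ∘ inj₁) (y∉ ∘ inj₂))))
    ... | yes _ | no x∉ = trans (⟨⟩-∷-cong y (⟨⟩-skip zs (x∉ ∘ inj₁) (x∉ ∘ inj₂)))
                                (sym (⟨⟩-skip (y ∷ zs) (x∉ ∘ inj₁) (x∉ ∘ inj₂)))
    ... | yes (inj₁ refl) | yes (inj₁ refl) = refl
    ... | yes (inj₂ refl) | yes (inj₂ refl) = refl
    ... | yes (inj₂ refl) | yes (inj₁ refl) = ⊥-elim (¬nb (inj₁ here))
    ... | yes (inj₁ refl) | yes (inj₂ refl) = ⊥-elim (¬nb (inj₂ here))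

    adjacentSwaps-⟨⟩ : ∀ L → ¬ Neighbours L P Q →
                       All (λ b → b ⟨ P , Q ⟩ ≡ L ⟨ P , Q ⟩) (adjacentSwaps L)
    adjacentSwaps-⟨⟩ (x ∷ y ∷ zs) ¬nb =
      ⟨⟩-swap zs ¬nb ∷
      All.map⁺ (All.map (⟨⟩-∷-cong x) (adjacentSwaps-⟨⟩ (y ∷ zs) (¬nb ∘ Sum.map there there)))
    adjacentSwaps-⟨⟩ []       _ = []
    adjacentSwaps-⟨⟩ (_ ∷ []) _ = []

    prefixed-⟨⟩ : ∀ {x} → x ≢ P → x ≢ Q → ∀ bs → map _⟨ P , Q ⟩ (map (x ∷_) bs) ≡ map _⟨ P , Q ⟩ bs
    prefixed-⟨⟩ x≢P x≢Q bs = trans (sym (map-∘ bs)) (map-cong (λ b → ⟨⟩-skip b x≢P x≢Q) bs)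

    pathBlocks-⟨⟩-∷ : ∀ {y z} zs → y ≢ P → y ≢ Q →
                      map _⟨ P , Q ⟩ (pathBlocks (y ∷ z ∷ zs))
                        ≡ (z ∷ zs) ⟨ P , Q ⟩ ∷ map _⟨ P , Q ⟩ (pathBlocks (z ∷ zs))
    pathBlocks-⟨⟩-∷ {y} {z} zs y≢P y≢Q =
      cong₂ _∷_ (⟨⟩-skip (z ∷ zs) y≢P y≢Q)
        (cong₂ _∷_ (⟨⟩-∷-cong z (⟨⟩-skip zs y≢P y≢Q))
                   (prefixed-⟨⟩ y≢P y≢Q (adjacentSwaps (z ∷ zs))))

    pathBlocks-flip : ∀ {L} → Unique L → Consecutive L P Q →
                      Consecutive (map _⟨ P , Q ⟩ (pathBlocks L)) (P ∷ Q ∷ []) (Q ∷ P ∷ [])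
    pathBlocks-flip {_ ∷ _ ∷ zs} ((_ ∷ P∉zs) ∷ Q∉zs ∷ _) here
      rewrite ⟨⟩-ordered P∉zs Q∉zs | ⟨⟩-comm (Q ∷ P ∷ zs) {P} {Q} | ⟨⟩-ordered Q∉zs P∉zs = here
    pathBlocks-flip {y ∷ z ∷ zs} (y∉ ∷ u) (there c) =
      subst (λ rs → Consecutive rs (P ∷ Q ∷ []) (Q ∷ P ∷ []))
        (sym (pathBlocks-⟨⟩-∷ {y} {z} zs (All.lookup y∉ (consecutive-∈ˡ c))
                                           (All.lookup y∉ (consecutive-∈ʳ c))))
        (there (pathBlocks-flip u c))
    pathBlocks-flip {_ ∷ []} _ (there ())

    ⟨⟩-single : ∀ {L} → Unique L → Q ∈ L → P ∉ L → L ⟨ P , Q ⟩ ≡ Q ∷ []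
    ⟨⟩-single {Q ∷ zs} (Q∉ ∷ _) (here refl) P∉ =
      trans (⟨⟩-keep zs (inj₂ refl)) (cong (Q ∷_) (⟨⟩-none (All.¬Any⇒All¬ zs (P∉ ∘ there)) Q∉))
    ⟨⟩-single {y ∷ zs} (y∉ ∷ u) (there Q∈) P∉ =
      trans (⟨⟩-skip zs (λ y≡P → P∉ (here (sym y≡P))) (All.lookup y∉ Q∈))
            (⟨⟩-single u Q∈ (P∉ ∘ there))

  ⟨⟩-pair : ∀ {L P Q} → Unique L → P ∈ L → Q ∈ L → P ≢ Q →
            ∃₂ λ s t → s ≢ t × L ⟨ P , Q ⟩ ≡ s ∷ t ∷ []
  ⟨⟩-pair _ (here refl) (here refl) P≢Q = ⊥-elim (P≢Q refl)
  ⟨⟩-pair {P ∷ zs} {Q = Q} (P∉ ∷ u) (here refl) (there Q∈) P≢Q =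
    P , Q , P≢Q ,
    trans (⟨⟩-keep zs (inj₁ refl)) (cong (P ∷_) (⟨⟩-single u Q∈ (All.All¬⇒¬Any P∉)))
  ⟨⟩-pair {Q ∷ zs} {P} (Q∉ ∷ u) (there P∈) (here refl) P≢Q =
    Q , P , P≢Q ∘ sym ,
    trans (⟨⟩-keep zs (inj₂ refl))
          (cong (Q ∷_) (trans (⟨⟩-comm zs) (⟨⟩-single u P∈ (All.All¬⇒¬Any Q∉))))
  ⟨⟩-pair {y ∷ zs} (y∉ ∷ u) (there P∈) (there Q∈) P≢Q =
    let s , t , s≢t , e = ⟨⟩-pair u P∈ Q∈ P≢Q
    in s , t , s≢t , trans (⟨⟩-skip zs (All.lookup y∉ P∈) (All.lookup y∉ Q∈)) e

  apexWord-alternate : ∀ {x L P Q} → Unique (x ∷ L) → P ∈ x ∷ L → Q ∈ x ∷ L → P ≢ Q →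
                       ¬ Neighbours L P Q → Alternate _≟_ (apexWord x L) P Q
  apexWord-alternate {x} {L} uniq P∈ Q∈ P≢Q ¬nb =
    let s , t , s≢t , e = ⟨⟩-pair uniq P∈ Q∈ P≢Q
    in uniform-alternate s≢t (map (x ∷_) (pathBlocks L))
         (All.map⁺ (e ∷ All.map (λ b≡L → trans (⟨⟩-∷-cong x b≡L) e) (adjacentSwaps-⟨⟩ L ¬nb)))

  consecutive-¬alternate : ∀ {x L P Q} → Unique (x ∷ L) → Consecutive L P Q →
                           ¬ Alternate _≟_ (apexWord x L) P Q
  consecutive-¬alternate {x} {L} {P} {Q} (x∉L ∷ uL) c =
    flipped-¬alternate (map (x ∷_) (pathBlocks L))
      (subst (λ rs → Consecutive rs (P ∷ Q ∷ []) (Q ∷ P ∷ []))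
        (sym (prefixed-⟨⟩ (All.lookup x∉L (consecutive-∈ˡ c)) (All.lookup x∉L (consecutive-∈ʳ c))
                          (pathBlocks L)))
        (pathBlocks-flip uL c))

  apexWord-alternate⇔ : ∀ {x L P Q} → Unique (x ∷ L) → P ∈ x ∷ L → Q ∈ x ∷ L → P ≢ Q →
                        Alternate _≟_ (apexWord x L) P Q ⇔ (¬ Neighbours L P Q)
  apexWord-alternate⇔ {x} {L} uniq P∈ Q∈ P≢Q = mk⇔ to (apexWord-alternate uniq P∈ Q∈ P≢Q)
    where
    to : Alternate _≟_ (apexWord x L) _ _ → ¬ Neighbours L _ _
    to alt (inj₁ c) = consecutive-¬alternate uniq c alt
    to alt (inj₂ c) = consecutive-¬alternate uniq c (alternate-sym (apexWord x L) alt)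

  module _ (v c : V) where

    attach : List V → List V
    attach []       = []
    attach (y ∷ ys) with y ≟ v
    ... | yes _ = y ∷ c ∷ attach ys
    ... | no _  = y ∷ attach ys

    pendant : List V → List V
    pendant []       = []
    pendant (y ∷ ys) with y ≟ v
    ... | yes _ = c ∷ y ∷ c ∷ attach ys
    ... | no _  = y ∷ pendant ys

    attach-∈ : ∀ {z w} → z ∈ w → z ∈ attach w
    attach-∈ {w = y ∷ ys} z∈ with y ≟ v | z∈
    ... | yes _ | here e  = here e
    ... | yes _ | there p = there (there (attach-∈ p))
    ... | no _  | here e  = here e
    ... | no _  | there p = there (attach-∈ p)

    pendant-∈ : ∀ {z w} → z ∈ w → z ∈ pendant w
    pendant-∈ {w = y ∷ ys} z∈ with y ≟ v | z∈
    ... | yes _ | here e  = there (here e)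
    ... | yes _ | there p = there (there (there (attach-∈ p)))
    ... | no _  | here e  = here e
    ... | no _  | there p = there (pendant-∈ p)

    module _ {Pr : V → Set} (pc : Pr c) where

      attach-All : ∀ {w} → All Pr w → All Pr (attach w)
      attach-All []                  = []
      attach-All {y ∷ _} (py ∷ pys) with y ≟ v
      ... | yes _ = py ∷ pc ∷ attach-All pys
      ... | no _  = py ∷ attach-All pys

      pendant-All : ∀ {w} → All Pr w → All Pr (pendant w)
      pendant-All []                  = []
      pendant-All {y ∷ _} (py ∷ pys) with y ≟ v
      ... | yes _ = pc ∷ py ∷ pc ∷ attach-All pys
      ... | no _  = py ∷ pendant-All pys

    module _ {P Q : V} (c≢P : c ≢ P) (c≢Q : c ≢ Q) where

      attach-⟨⟩ : ∀ w → attach w ⟨ P , Q ⟩ ≡ w ⟨ P , Q ⟩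
      attach-⟨⟩ []       = refl
      attach-⟨⟩ (y ∷ ys) with y ≟ v
      ... | yes _ = ⟨⟩-∷-cong y (trans (⟨⟩-skip _ c≢P c≢Q) (attach-⟨⟩ ys))
      ... | no _  = ⟨⟩-∷-cong y (attach-⟨⟩ ys)

      pendant-⟨⟩ : ∀ w → pendant w ⟨ P , Q ⟩ ≡ w ⟨ P , Q ⟩
      pendant-⟨⟩ []       = refl
      pendant-⟨⟩ (y ∷ ys) with y ≟ v
      ... | yes _ = trans (⟨⟩-skip _ c≢P c≢Q)
                          (⟨⟩-∷-cong y (trans (⟨⟩-skip _ c≢P c≢Q) (attach-⟨⟩ ys)))
      ... | no _  = ⟨⟩-∷-cong y (pendant-⟨⟩ ys)

    module _ (c≢v : c ≢ v) where

      attach-linked : ∀ {w} → All (_≢ c) w → Linked _≢_ (c ∷ attach w ⟨ c , v ⟩)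
      attach-linked []                  = [-]
      attach-linked {y ∷ ys} (y≢c ∷ cs) with y ≟ v
      ... | yes refl rewrite ⟨⟩-keep {c} {v} (c ∷ attach ys) (inj₂ refl)
                           | ⟨⟩-keep {c} {v} (attach ys) (inj₁ refl) =
        c≢v ∷ (c≢v ∘ sym) ∷ attach-linked cs
      ... | no y≢v rewrite ⟨⟩-skip {c} {v} (attach ys) y≢c y≢v = attach-linked cs

      pendant-linked : ∀ {w} → All (_≢ c) w → Linked _≢_ (pendant w ⟨ c , v ⟩)
      pendant-linked []                  = []
      pendant-linked {y ∷ ys} (y≢c ∷ cs) with y ≟ v
      ... | yes refl rewrite ⟨⟩-keep {c} {v} (v ∷ c ∷ attach ys) (inj₁ refl)
                           | ⟨⟩-keep {c} {v} (c ∷ attach ys) (inj₂ refl)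
                           | ⟨⟩-keep {c} {v} (attach ys) (inj₁ refl) =
        c≢v ∷ (c≢v ∘ sym) ∷ attach-linked cs
      ... | no y≢v rewrite ⟨⟩-skip {c} {v} (pendant ys) y≢c y≢v = pendant-linked cs

      pendant-factor : ∀ {w y} → v ∈ w → All (_≢ c) w → y ≢ v →
                       HasFactor _≟_ c (pendant w ⟨ c , y ⟩)
      pendant-factor {z ∷ zs} {y} v∈ (z≢c ∷ cs) y≢v with z ≟ v
      ... | yes refl rewrite ⟨⟩-keep {c} {y} (v ∷ c ∷ attach zs) (inj₁ refl)
                           | ⟨⟩-skip {c} {y} (c ∷ attach zs) z≢c (y≢v ∘ sym)
                           | ⟨⟩-keep {c} {y} (attach zs) (inj₁ refl) = here
      ... | no z≢v = factor-∷ z (pendant zs) (pendant-factor (tail v∈) cs y≢v)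
        where
        tail : v ∈ z ∷ zs → v ∈ zs
        tail (here v≡z) = ⊥-elim (z≢v (sym v≡z))
        tail (there p)  = p

      pendant-alternate⇔ : ∀ {w y} → v ∈ w → All (_≢ c) w →
                           Alternate _≟_ (pendant w) c y ⇔ y ≡ v
      pendant-alternate⇔ {w} {y} v∈ cs = mk⇔ to from
        where
        to : Alternate _≟_ (pendant w) c y → y ≡ v
        to (¬c , _) with y ≟ v
        ... | yes y≡v = y≡v
        ... | no y≢v  = ⊥-elim (¬c (pendant-factor v∈ cs y≢v))
        from : y ≡ v → Alternate _≟_ (pendant w) c y
        from refl = linked⇒alternate {pendant w} (pendant-linked cs)

NextTo : ℕ → ℕ → Set
NextTo m k = suc m ≡ k ⊎ suc k ≡ m

FarApart : ℕ → ℕ → Set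
FarApart m k = 2 + m ≤ k ⊎ 2 + k ≤ m

farApart⇔¬nextTo : ∀ {m k} → m ≢ k → FarApart m k ⇔ (¬ NextTo m k)
farApart⇔¬nextTo {m} {k} m≢k = mk⇔ to from
  where
  to : FarApart m k → ¬ NextTo m k
  to (inj₁ h) (inj₁ refl) = <-irrefl refl h
  to (inj₁ h) (inj₂ refl) = m+n≮n 2 k h
  to (inj₂ h) (inj₁ refl) = m+n≮n 2 m h
  to (inj₂ h) (inj₂ refl) = <-irrefl refl h
  from : ¬ NextTo m k → FarApart m k
  from ¬nt with <-cmp m k
  ... | tri< m<k _ _ = inj₁ (≤∧≢⇒< m<k (¬nt ∘ inj₁))
  ... | tri≈ _ m≡k _ = ⊥-elim (m≢k m≡k)
  ... | tri> _ _ k<m = inj₂ (≤∧≢⇒< k<m (¬nt ∘ inj₂))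

module _ {n : ℕ} where

  data OnPath : V7 n → Set where
    onA : OnPath va
    onI : ∀ k → OnPath (num k)
    onD : OnPath vd

  rank : ∀ {u} → OnPath u → ℕ
  rank onA     = 0
  rank (onI k) = idx k
  rank onD     = suc n

  rank< : ∀ {u} (p : OnPath u) → rank p < 2 + n
  rank< onA     = s≤s z≤n
  rank< (onI k) = s≤s (m≤n⇒m≤1+n (toℕ<n k))
  rank< onD     = n<1+n (suc n)

  pathVertex : ℕ → V7 n
  pathVertex zero    = va
  pathVertex (suc j) with j <? n
  ... | yes j<n = num (fromℕ< j<n)
  ... | no _    = vd

  path : List (V7 n)
  path = applyUpTo pathVertex (2 + n)

  onPath-pathVertex : ∀ j → OnPath (pathVertex j)
  onPath-pathVertex zero = onA
  onPath-pathVertex (suc j) with j <? n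
  ... | yes j<n = onI (fromℕ< j<n)
  ... | no _    = onD

  pathVertex-rank : ∀ {u} (p : OnPath u) → pathVertex (rank p) ≡ u
  pathVertex-rank onA = refl
  pathVertex-rank (onI k) with toℕ k <? n
  ... | yes k<n = cong num (fromℕ<-toℕ k k<n)
  ... | no k≮n  = ⊥-elim (k≮n (toℕ<n k))
  pathVertex-rank onD with n <? n
  ... | yes n<n = ⊥-elim (<-irrefl refl n<n)
  ... | no _    = refl

  rank-pathVertex : ∀ {j u} → j < 2 + n → pathVertex j ≡ u → (p : OnPath u) → rank p ≡ j
  rank-pathVertex {zero} _ refl onA = refl
  rank-pathVertex {suc j} j<2+n e p with j <? n
  rank-pathVertex {suc j} j<2+n refl (onI _) | yes j<n = cong suc (toℕ-fromℕ< j<n)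
  rank-pathVertex {suc j} j<2+n refl onD     | no j≮n with <-cmp j n
  ... | tri< j<n _ _  = ⊥-elim (j≮n j<n)
  ... | tri≈ _ refl _ = refl
  ... | tri> _ _ n<j  = ⊥-elim (<-irrefl refl (<-≤-trans n<j (≤-pred (≤-pred j<2+n))))

  onPath-∈ : ∀ {u} → OnPath u → u ∈ path
  onPath-∈ p = subst (_∈ path) (pathVertex-rank p) (∈-applyUpTo⁺ pathVertex (rank< p))

  ∈-onPath : ∀ {u} → u ∈ path → OnPath u
  ∈-onPath u∈ with ∈-applyUpTo⁻ pathVertex u∈
  ... | j , _ , refl = onPath-pathVertex j

  path-unique : Unique path
  path-unique = applyUpTo⁺₁ pathVertex (2 + n) λ {j} {k} j<k k<2+n e →
    <⇒≢ j<k (trans (sym (rank-pathVertex (<-trans j<k k<2+n) e (onPath-pathVertex k)))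
                   (rank-pathVertex k<2+n refl (onPath-pathVertex k)))

  consecutive-path⇔ : ∀ {u v} (p : OnPath u) (q : OnPath v) →
                      Consecutive path u v ⇔ suc (rank p) ≡ rank q
  consecutive-path⇔ p q = mk⇔ to from
    where
    to : Consecutive path _ _ → suc (rank p) ≡ rank q
    to c with consecutive-applyUpTo⁻ pathVertex c
    ... | j , 1+j<2+n , e₁ , e₂ =
      trans (cong suc (rank-pathVertex (<-trans (n<1+n j) 1+j<2+n) e₁ p))
            (sym (rank-pathVertex 1+j<2+n e₂ q))
    from : suc (rank p) ≡ rank q → Consecutive path _ _
    from e = subst₂ (Consecutive path) (pathVertex-rank p)
                    (trans (cong pathVertex e) (pathVertex-rank q))
                    (consecutive-applyUpTo⁺ pathVertex (subst (_< 2 + n) (sym e) (rank< q)))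

  neighbours-path⇔ : ∀ {u v} (p : OnPath u) (q : OnPath v) →
                     Neighbours path u v ⇔ NextTo (rank p) (rank q)
  neighbours-path⇔ p q = consecutive-path⇔ p q ⊎-⇔ consecutive-path⇔ q p

  arc-farApart : 1 ≤ n → ∀ {u v} → Arc n u v → (p : OnPath u) (q : OnPath v) →
                 FarApart (rank p) (rank q)
  arc-farApart 1≤n ad           onA     onD     = inj₁ (s≤s 1≤n)
  arc-farApart _   (ij k l h)   (onI k) (onI l) = inj₁ h
  arc-farApart _   (ai k 2≤k)   onA     (onI k) = inj₁ 2≤k
  arc-farApart _   (di k 1+k≤n) onD     (onI k) = inj₂ (s≤s 1+k≤n)
  arc-farApart _   ac           _       ()
  arc-farApart _   bd           ()      _
  arc-farApart _   (xi _)       ()      _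
  arc-farApart _   xa           ()      _
  arc-farApart _   xd           ()      _

  farApart-edge : ∀ {u v} (p : OnPath u) (q : OnPath v) → FarApart (rank p) (rank q) → Edge7 n u v
  farApart-edge onA     onA     (inj₁ ())
  farApart-edge onA     onA     (inj₂ ())
  farApart-edge onA     (onI k) (inj₁ 2≤k)     = inj₁ (ai k 2≤k)
  farApart-edge onA     onD     _              = inj₁ ad
  farApart-edge (onI k) onA     (inj₂ 2≤k)     = inj₂ (ai k 2≤k)
  farApart-edge (onI k) (onI l) (inj₁ h)       = inj₁ (ij k l h)
  farApart-edge (onI k) (onI l) (inj₂ h)       = inj₂ (ij l k h)
  farApart-edge (onI k) onD     (inj₁ (s≤s h)) = inj₂ (di k h)
  farApart-edge (onI k) onD     (inj₂ h)       = ⊥-elim (m+n≮n 1 n (≤-trans (≤-pred h) (<⇒≤ (toℕ<n k))))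
  farApart-edge onD     onA     _              = inj₂ ad
  farApart-edge onD     (onI k) (inj₁ h)       = ⊥-elim (m+n≮n 1 n (≤-trans (≤-pred h) (<⇒≤ (toℕ<n k))))
  farApart-edge onD     (onI k) (inj₂ (s≤s h)) = inj₁ (di k h)
  farApart-edge onD     onD     (inj₁ h)       = ⊥-elim (m+n≮n 1 _ h)
  farApart-edge onD     onD     (inj₂ h)       = ⊥-elim (m+n≮n 1 _ h)

  edge⇔farApart : 1 ≤ n → ∀ {u v} (p : OnPath u) (q : OnPath v) →
                  Edge7 n u v ⇔ FarApart (rank p) (rank q)
  edge⇔farApart 1≤n p q =
    mk⇔ Sum.[ (λ arc → arc-farApart 1≤n arc p q) , (λ arc → Sum.swap (arc-farApart 1≤n arc q p)) ]
        (farApart-edge p q)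

  apex-edge : ∀ {v} → OnPath v → Edge7 n vx v
  apex-edge onA     = inj₁ xa
  apex-edge (onI k) = inj₁ (xi k)
  apex-edge onD     = inj₁ xd

  edge-vc⇔ : ∀ {v} → Edge7 n vc v ⇔ v ≡ va
  edge-vc⇔ = mk⇔ (λ { (inj₁ ()) ; (inj₂ ac) → refl }) (λ { refl → inj₂ ac })

  edge-vb⇔ : ∀ {v} → Edge7 n vb v ⇔ v ≡ vd
  edge-vb⇔ = mk⇔ (λ { (inj₁ bd) → refl ; (inj₂ ()) }) (λ { refl → inj₁ bd })

  open Alternation (_≟7_ {n})

  Core : V7 n → Set
  Core u = u ∈ vx ∷ path

  vx∉path : vx ∉ path
  vx∉path x∈ with ∈-onPath x∈
  ... | ()

  core-unique : Unique (vx ∷ path)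
  core-unique = All.¬Any⇒All¬ path vx∉path ∷ path-unique

  core-≢ : ∀ {u z} → Core u → ¬ OnPath z → z ≢ vx → u ≢ z
  core-≢ (here refl) _    x≢x refl = x≢x refl
  core-≢ (there u∈)  ¬onP _   refl = ¬onP (∈-onPath u∈)

  core-≢vb : ∀ {u} → Core u → u ≢ vb
  core-≢vb u∈ = core-≢ u∈ (λ ()) (λ ())

  core-≢vc : ∀ {u} → Core u → u ≢ vc
  core-≢vc u∈ = core-≢ u∈ (λ ()) (λ ())

  core-edge⇔ : 1 ≤ n → ∀ {u v} → Core u → Core v → u ≢ v → Edge7 n u v ⇔ (¬ Neighbours path u v)
  core-edge⇔ _ (here refl) (here refl) u≢v = ⊥-elim (u≢v refl)
  core-edge⇔ _ (here refl) (there v∈) _ =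
    mk⇔ (λ _ → vx∉path ∘ neighbours-∈ˡ) (λ _ → apex-edge (∈-onPath v∈))
  core-edge⇔ _ (there u∈) (here refl) _ =
    mk⇔ (λ _ → vx∉path ∘ neighbours-∈ʳ) (λ _ → Sum.swap (apex-edge (∈-onPath u∈)))
  core-edge⇔ 1≤n (there u∈) (there v∈) u≢v =
    ⇔.trans (edge⇔farApart 1≤n p q)
      (⇔.trans (farApart⇔¬nextTo rank-injective) (¬-cong-⇔ (⇔.sym (neighbours-path⇔ p q))))
    where
    p = ∈-onPath u∈
    q = ∈-onPath v∈
    rank-injective : rank p ≢ rank q
    rank-injective e =
      u≢v (trans (sym (pathVertex-rank p)) (trans (cong pathVertex e) (pathVertex-rank q)))

  core : List (V7 n)
  core = apexWord vx path

  coreB : List (V7 n)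
  coreB = pendant vd vb core

  word : List (V7 n)
  word = pendant va vc coreB

  core-letters : All Core core
  core-letters = All-apexWord (here refl) (All.tabulate there)

  vd∈core : vd ∈ core
  vd∈core = there (∈-++⁺ˡ (onPath-∈ onD))

  va∈coreB : va ∈ coreB
  va∈coreB = pendant-∈ vd vb {w = core} (there (∈-++⁺ˡ (onPath-∈ onA)))

  vc∉coreB : All (_≢ vc) coreB
  vc∉coreB = pendant-All vd vb (λ ()) (All.map core-≢vc core-letters)

  vc-edge⇔alternate : ∀ {v} → Edge7 n vc v ⇔ Alternate _≟7_ word vc v
  vc-edge⇔alternate = ⇔.trans edge-vc⇔ (⇔.sym (pendant-alternate⇔ va vc (λ ()) va∈coreB vc∉coreB))

  vb-edge⇔alternate : ∀ {v} → v ≢ vc → Edge7 n vb v ⇔ Alternate _≟7_ word vb v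
  vb-edge⇔alternate {v} v≢c =
    ⇔.trans (edge-vb⇔ {v})
      (⇔.trans (⇔.sym (pendant-alternate⇔ vd vb (λ ()) {y = v} vd∈core (All.map core-≢vb core-letters)))
               (alternate-resp {coreB} {word} (sym (pendant-⟨⟩ va vc {vb} {v} (λ ()) (v≢c ∘ sym) coreB))))

  core-edge⇔alternate : 1 ≤ n → ∀ {u v} → Core u → Core v → u ≢ v →
                        Edge7 n u v ⇔ Alternate _≟7_ word u v
  core-edge⇔alternate 1≤n {u} {v} u∈ v∈ u≢v =
    ⇔.trans (core-edge⇔ 1≤n u∈ v∈ u≢v)
      (⇔.trans (⇔.sym (apexWord-alternate⇔ core-unique u∈ v∈ u≢v))
               (alternate-resp {core} {word} (sym word≈core)))
    where
    word≈core : word ⟨ u , v ⟩ ≡ core ⟨ u , v ⟩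
    word≈core = trans (pendant-⟨⟩ va vc (core-≢vc u∈ ∘ sym) (core-≢vc v∈ ∘ sym) coreB)
                      (pendant-⟨⟩ vd vb (core-≢vb u∈ ∘ sym) (core-≢vb v∈ ∘ sym) core)

  swap-edge⇔alternate : ∀ {u v} → Edge7 n u v ⇔ Alternate _≟7_ word u v →
                        Edge7 n v u ⇔ Alternate _≟7_ word v u
  swap-edge⇔alternate e⇔a = mk⇔ (alternate-sym word ∘ Equivalence.to e⇔a ∘ Sum.swap)
                                (Sum.swap ∘ Equivalence.from e⇔a ∘ alternate-sym word)

  classify : ∀ u → u ≡ vc ⊎ u ≡ vb ⊎ Core u
  classify va      = inj₂ (inj₂ (there (onPath-∈ onA)))
  classify vb      = inj₂ (inj₁ refl)
  classify vc      = inj₁ refl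
  classify vd      = inj₂ (inj₂ (there (onPath-∈ onD)))
  classify vx      = inj₂ (inj₂ (here refl))
  classify (num k) = inj₂ (inj₂ (there (onPath-∈ (onI k))))

  edge⇔alternate : 1 ≤ n → ∀ u v → u ≢ v → Edge7 n u v ⇔ Alternate _≟7_ word u v
  edge⇔alternate 1≤n u v u≢v with classify u | classify v
  ... | inj₁ refl        | _                = vc-edge⇔alternate
  ... | _                | inj₁ refl        = swap-edge⇔alternate vc-edge⇔alternate
  ... | inj₂ (inj₁ refl) | inj₂ (inj₁ refl) = ⊥-elim (u≢v refl)
  ... | inj₂ (inj₁ refl) | inj₂ (inj₂ v∈)   = vb-edge⇔alternate (core-≢vc v∈)
  ... | inj₂ (inj₂ u∈)   | inj₂ (inj₁ refl) = swap-edge⇔alternate (vb-edge⇔alternate (core-≢vc u∈))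
  ... | inj₂ (inj₂ u∈)   | inj₂ (inj₂ v∈)   = core-edge⇔alternate 1≤n u∈ v∈ u≢v

theorem7 : ∀ (n : ℕ) → 1 ≤ n → WordRepresentable _≟7_ (Edge7 n)
theorem7 n 1≤n = word , edge⇔alternate 1≤n
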